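{- For every $n\geq 2$, $\kappa(BH_n;C_4)\leq n$ and $\kappa^s(BH_n;C_4)\leq n$.
   Context: The $n$-dimensional balanced hypercube $BH_n$ is the graph with vertex set $\{0,1,2,3\}^n$, vertices written $(a_0,a_1,\dots,a_{n-1})$, in which $(a_0,\dots,a_{n-1})$ is adjacent exactly to the $2n$ vertices $((a_0\pm 1)\bmod 4,a_1,\dots,a_{n-1})$ and, for each $1\le i\le n-1$, $((a_0\pm1)\bmod 4,a_1,\dots,a_{i-1},(a_i+(-1)^{a_0})\bmod 4,a_{i+1},\dots,a_{n-1})$. For a connected graph $G$ and a set $F$ of connected subgraphs of $G$, let $V(F)$ be the union of their vertex sets; $F$ is a subgraph-cut if $G-V(F)$ is disconnected or trivial. For a connected subgraph $H$ of $G$, an $H$-structure-cut is a subgraph-cut each of whose elements is isomorphic to $H$, and $\kappa(G;H)$ is the minimum cardinality of an $H$-structure-cut; an $H$-substructure-cut is a subgraph-cut each of whose elements is isomorphic to a connected subgraph of $H$, and $\kappa^s(G;H)$ is the minimum cardinality of an $H$-substructure-cut. $C_4$ is the cycle on four vertices. -}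

module Defs where

open import Data.Nat using (ℕ; zero; suc; _≤_)
open import Data.Fin using (Fin; zero; suc)
open import Data.Vec using (Vec; _∷_; []; lookup; _[_]≔_)
open import Data.List using (List; length; _∷_; [])
open import Data.List.Membership.Propositional using (_∈_)
open import Data.List.Relation.Unary.Any using (Any)
open import Data.Product using (Σ; ∃; _×_; _,_)
open import Data.Sum using (_⊎_)
open import Relation.Binary.PropositionalEquality using (_≡_; _≢_)
open import Relation.Nullary using (¬_)

inc4 : Fin 4 → Fin 4
inc4 zero = suc zero
inc4 (suc zero) = suc (suc zero)
inc4 (suc (suc zero)) = suc (suc (suc zero))
inc4 (suc (suc (suc zero))) = zero

dec4 : Fin 4 → Fin 4
dec4 zero = suc (suc (suc zero))
dec4 (suc zero) = zero
dec4 (suc (suc zero)) = suc zero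
dec4 (suc (suc (suc zero))) = suc (suc zero)

shift : Fin 4 → Fin 4 → Fin 4
shift zero x = inc4 x
shift (suc zero) x = dec4 x
shift (suc (suc zero)) x = inc4 x
shift (suc (suc (suc zero))) x = dec4 x

PM1 : Fin 4 → Fin 4 → Set
PM1 a b = (b ≡ inc4 a) ⊎ (b ≡ dec4 a)

-- Vertices of BH_n: (a_0, a_1, ..., a_{n-1}), a_0 is the head of the vector
Vtx : ℕ → Set
Vtx n = Vec (Fin 4) n

-- Adjacency of the balanced hypercube BH_n.
-- For a vertex a₀ ∷ xs (so xs = (a_1,...,a_{n-1})), index i : Fin m of xs
-- corresponds to coordinate i+1 ∈ {1,...,n-1}.
data Adj : {n : ℕ} → Vtx n → Vtx n → Set where
  inner : ∀ {m} (a₀ b₀ : Fin 4) (xs : Vec (Fin 4) m) →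
          PM1 a₀ b₀ → Adj (a₀ ∷ xs) (b₀ ∷ xs)
  outer : ∀ {m} (a₀ b₀ : Fin 4) (xs : Vec (Fin 4) m) (i : Fin m) →
          PM1 a₀ b₀ → Adj (a₀ ∷ xs) (b₀ ∷ (xs [ i ]≔ shift a₀ (lookup xs i)))

-- Walks in BH_n all of whose vertices satisfy `ok` (the start vertex is
-- required to satisfy `ok` separately where used).
data Walk {n : ℕ} (ok : Vtx n → Set) : Vtx n → Vtx n → Set where
  here : ∀ {u} → Walk ok u u
  step : ∀ {u w v} → Adj u w → ok w → Walk ok w v → Walk ok u v

DisconnectedOrTrivialAfterRemoving : {n : ℕ} → (Vtx n → Set) → Set
DisconnectedOrTrivialAfterRemoving {n} R =
  (Σ (Vtx n) λ u → Σ (Vtx n) λ v →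
     ¬ R u × ¬ R v × ¬ Walk (λ w → ¬ R w) u v)
  ⊎ (Σ (Vtx n) λ v → ¬ R v × ((w : Vtx n) → ¬ R w → w ≡ v))

record C4In (n : ℕ) : Set where
  field
    v0 v1 v2 v3 : Vtx n
    d01 : v0 ≢ v1
    d02 : v0 ≢ v2
    d03 : v0 ≢ v3
    d12 : v1 ≢ v2
    d13 : v1 ≢ v3
    d23 : v2 ≢ v3
    e01 : Adj v0 v1
    e12 : Adj v1 v2
    e23 : Adj v2 v3
    e30 : Adj v3 v0

C4verts : {n : ℕ} → C4In n → List (Vtx n)
C4verts c = C4In.v0 c ∷ C4In.v1 c ∷ C4In.v2 c ∷ C4In.v3 c ∷ []

-- A subgraph of BH_n isomorphic to a connected subgraph of C_4, i.e. to
-- one of K_1 = P_1, K_2 = P_2, P_3, P_4, C_4.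
data SubC4In (n : ℕ) : Set where
  p1 : (a : Vtx n) → SubC4In n
  p2 : (a b : Vtx n) → a ≢ b → Adj a b → SubC4In n
  p3 : (a b c : Vtx n) → a ≢ b → a ≢ c → b ≢ c →
       Adj a b → Adj b c → SubC4In n
  p4 : (a b c d : Vtx n) → a ≢ b → a ≢ c → a ≢ d → b ≢ c → b ≢ d → c ≢ d →
       Adj a b → Adj b c → Adj c d → SubC4In n
  cyc : C4In n → SubC4In n

SubC4verts : {n : ℕ} → SubC4In n → List (Vtx n)
SubC4verts (p1 a) = a ∷ []
SubC4verts (p2 a b _ _) = a ∷ b ∷ []
SubC4verts (p3 a b c _ _ _ _ _) = a ∷ b ∷ c ∷ []
SubC4verts (p4 a b c d _ _ _ _ _ _ _ _ _) = a ∷ b ∷ c ∷ d ∷ []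
SubC4verts (cyc q) = C4verts q

InVF : {n : ℕ} {S : Set} → (S → List (Vtx n)) → List S → Vtx n → Set
InVF vs F v = Any (λ s → v ∈ vs s) F

-- κ(BH_n; C_4) ≤ k : there is a C_4-structure-cut with at most k elements
-- (a list of length ≤ k represents a set of cardinality ≤ k)
KappaC4≤ : ℕ → ℕ → Set
KappaC4≤ n k = Σ (List (C4In n)) λ F →
  length F ≤ k × DisconnectedOrTrivialAfterRemoving (InVF C4verts F)

KappaSC4≤ : ℕ → ℕ → Set
KappaSC4≤ n k = Σ (List (SubC4In n)) λ F →
  length F ≤ k × DisconnectedOrTrivialAfterRemoving (InVF SubC4verts F)

module Submission where

-- Idea: isolate the origin o = (0,0,...,0) of BH_n.  Its 2n neighbours are
-- (±1, 0,...,0) and (±1, e_i) for the n-1 unit vectors e_i of the last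
-- n-1 coordinates.  For a fixed tail xs the four vertices (a, xs),
-- a ∈ Z_4, form a 4-cycle (the "fibre cycle" of xs), so the n-1 fibre
-- cycles of the e_i cover all outer neighbours; one more 4-cycle through
-- (1,0,...),(2,0,...),(3,0,...),(2,3,0,...) covers the two inner ones.
-- None of these n cycles contains o or w = (0,2,0,...,0), so removing
-- them separates o from w.

open import Defs
open import Data.Nat using (ℕ; _≤_; suc; z≤n; s≤s)
open import Data.Nat.Properties using (≤-reflexive)
open import Data.Fin using (Fin; zero; suc)
open import Data.Vec using (Vec; _∷_; lookup; _[_]≔_; replicate; tail)
open import Data.Vec.Properties using (lookup∘update; lookup-replicate)
open import Data.List using (List; length; _∷_; map; allFin)
open import Data.List.Properties using (length-map; length-tabulate)
open import Data.List.Relation.Unary.Any using (here; there; satisfied)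
import Data.List.Relation.Unary.Any as Any
open import Data.List.Relation.Unary.Any.Properties using (map⁺; map⁻)
open import Data.List.Membership.Propositional using (_∈_)
open import Data.List.Membership.Propositional.Properties using (∈-allFin)
open import Data.Product using (_×_; _,_; ∃)
open import Data.Sum using (inj₁; inj₂)
open import Relation.Binary.PropositionalEquality
open import Relation.Nullary using (¬_)

walk-weaken : ∀ {n} {R S : Vtx n → Set} → (∀ {w} → R w → S w) →
              ∀ {u v} → Walk (λ w → ¬ S w) u v → Walk (λ w → ¬ R w) u v
walk-weaken R⊆S here = here
walk-weaken R⊆S (step a ok p) = step a (λ r → ok (R⊆S r)) (walk-weaken R⊆S p)

cut-resp : ∀ {n} {R S : Vtx n → Set} → (∀ {w} → R w → S w) → (∀ {w} → S w → R w) →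
           DisconnectedOrTrivialAfterRemoving R → DisconnectedOrTrivialAfterRemoving S
cut-resp R⊆S S⊆R (inj₁ (u , v , ¬Ru , ¬Rv , noWalk)) =
  inj₁ (u , v , (λ s → ¬Ru (S⊆R s)) , (λ s → ¬Rv (S⊆R s)) , λ p → noWalk (walk-weaken R⊆S p))
cut-resp R⊆S S⊆R (inj₂ (v , ¬Rv , only)) =
  inj₂ (v , (λ s → ¬Rv (S⊆R s)) , λ w ¬Sw → only w (λ r → ¬Sw (R⊆S r)))

isolated-cut : ∀ {n} (R : Vtx n → Set) (u v : Vtx n) → u ≢ v → ¬ R u → ¬ R v →
               (∀ {w} → Adj u w → R w) → DisconnectedOrTrivialAfterRemoving R
isolated-cut R u v u≢v ¬Ru ¬Rv nbrs = inj₁ (u , v , ¬Ru , ¬Rv , noWalk)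
  where
  noWalk : ¬ Walk (λ w → ¬ R w) u v
  noWalk here = u≢v refl
  noWalk (step a ok _) = ok (nbrs a)

structure⇒substructure : ∀ {n k} → KappaC4≤ n k → KappaSC4≤ n k
structure⇒substructure {k = k} (F , |F|≤k , cut) =
  map cyc F
  , subst (_≤ k) (sym (length-map cyc F)) |F|≤k
  , cut-resp (map⁺ {f = cyc} {xs = F}) (map⁻ {f = cyc} {xs = F}) cut

f0 f1 f2 f3 : Fin 4
f0 = zero
f1 = suc zero
f2 = suc (suc zero)
f3 = suc (suc (suc zero))

fibre : ∀ {m} → Vec (Fin 4) m → C4In (suc m)
fibre xs = record
  { v0 = f0 ∷ xs ; v1 = f1 ∷ xs ; v2 = f2 ∷ xs ; v3 = f3 ∷ xs
  ; d01 = λ () ; d02 = λ () ; d03 = λ () ; d12 = λ () ; d13 = λ () ; d23 = λ ()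
  ; e01 = inner f0 f1 xs (inj₁ refl)
  ; e12 = inner f1 f2 xs (inj₁ refl)
  ; e23 = inner f2 f3 xs (inj₁ refl)
  ; e30 = inner f3 f0 xs (inj₁ refl) }

fibre-tail : ∀ {m} {xs : Vec (Fin 4) m} {w} → w ∈ C4verts (fibre xs) → tail w ≡ xs
fibre-tail (here refl) = refl
fibre-tail (there (here refl)) = refl
fibre-tail (there (there (here refl))) = refl
fibre-tail (there (there (there (here refl)))) = refl

𝟎 : (m : ℕ) → Vec (Fin 4) m
𝟎 m = replicate m f0

-- It contains both inner
-- neighbours (±1,0,…,0) of the origin; it needs n ≥ 2.
cap : (k : ℕ) → C4In (suc (suc k))
cap k = record
  { v0 = f1 ∷ 𝟎 (suc k) ; v1 = f2 ∷ 𝟎 (suc k) ; v2 = f3 ∷ 𝟎 (suc k) ; v3 = f2 ∷ f3 ∷ 𝟎 k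
  ; d01 = λ () ; d02 = λ () ; d03 = λ () ; d12 = λ () ; d13 = λ () ; d23 = λ ()
  ; e01 = inner f1 f2 (𝟎 (suc k)) (inj₁ refl)
  ; e12 = inner f2 f3 (𝟎 (suc k)) (inj₁ refl)
  ; e23 = outer f3 f2 (𝟎 (suc k)) zero (inj₂ refl)
  ; e30 = outer f2 f1 (f3 ∷ 𝟎 k) zero (inj₂ refl) }

cap-head≢0 : ∀ {k ys} → ¬ (f0 ∷ ys) ∈ C4verts (cap k)
cap-head≢0 (here ())
cap-head≢0 (there (here ()))
cap-head≢0 (there (there (here ())))
cap-head≢0 (there (there (there (here ()))))
cap-head≢0 (there (there (there (there ()))))

-- The unit vector e_i, written as the tail of the outer neighbour of the
-- origin across coordinate i.
unit : ∀ {m} → Fin m → Vec (Fin 4) m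
unit {m} i = 𝟎 m [ i ]≔ shift f0 (lookup (𝟎 m) i)

unit-at : ∀ {m} (i : Fin m) → lookup (unit i) i ≡ f1
unit-at {m} i = trans (lookup∘update i (𝟎 m) _) (cong inc4 (lookup-replicate i f0))

≢unit : ∀ {m} {ys : Vec (Fin 4) m} (i : Fin m) → lookup ys i ≢ f1 → ys ≢ unit i
≢unit i ys[i]≢1 ys≡e = ys[i]≢1 (trans (cong (λ zs → lookup zs i) ys≡e) (unit-at i))

cutFamily : (k : ℕ) → List (C4In (suc (suc k)))
cutFamily k = cap k ∷ map (λ i → fibre (unit i)) (allFin (suc k))

removed : (k : ℕ) → Vtx (suc (suc k)) → Set
removed k = InVF C4verts (cutFamily k)

|cutFamily| : ∀ k → length (cutFamily k) ≡ suc (suc k)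
|cutFamily| k = cong suc (trans (length-map _ (allFin (suc k))) (length-tabulate (λ i → i)))

fibre-removed : ∀ k (i : Fin (suc k)) {w} → w ∈ C4verts (fibre (unit i)) → removed k w
fibre-removed k i w∈ = there (map⁺ (Any.map (λ { refl → w∈ }) (∈-allFin i)))

removed-head0 : ∀ {k ys} → removed k (f0 ∷ ys) → ∃ λ i → ys ≡ unit i
removed-head0 (here w∈cap) with cap-head≢0 w∈cap
... | ()
removed-head0 {k} (there w∈fibres) with satisfied (map⁻ {xs = allFin (suc k)} w∈fibres)
... | i , w∈fibre = i , fibre-tail w∈fibre

origin far : (k : ℕ) → Vtx (suc (suc k))
origin k = f0 ∷ 𝟎 (suc k)
far k = f0 ∷ f2 ∷ 𝟎 k

origin-nbrs-removed : ∀ k {w} → Adj (origin k) w → removed k w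
origin-nbrs-removed k (inner _ _ _ (inj₁ refl)) = here (here refl)
origin-nbrs-removed k (inner _ _ _ (inj₂ refl)) = here (there (there (here refl)))
origin-nbrs-removed k (outer _ _ _ i (inj₁ refl)) = fibre-removed k i (there (here refl))
origin-nbrs-removed k (outer _ _ _ i (inj₂ refl)) =
  fibre-removed k i (there (there (there (here refl))))

𝟎-entry≢1 : ∀ {m} (i : Fin m) → lookup (𝟎 m) i ≢ f1
𝟎-entry≢1 i 0≡1 with trans (sym (lookup-replicate i f0)) 0≡1
... | ()

-- Both the origin (tail 0) and the far vertex (tail (2,0,…)) have first
-- coordinate 0 and a tail different from every e_i, so neither is removed.
origin-survives : ∀ k → ¬ removed k (origin k)
origin-survives k r with removed-head0 r
... | i , eq = ≢unit i (𝟎-entry≢1 i) eq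

far-survives : ∀ k → ¬ removed k (far k)
far-survives k r with removed-head0 r
... | zero , eq = ≢unit zero (λ ()) eq
... | suc j , eq = ≢unit (suc j) (𝟎-entry≢1 j) eq

lemma15 : (n : ℕ) → 2 ≤ n → KappaC4≤ n n × KappaSC4≤ n n
lemma15 (suc (suc k)) (s≤s (s≤s z≤n)) = bound , structure⇒substructure bound
  where
  bound : KappaC4≤ (suc (suc k)) (suc (suc k))
  bound = cutFamily k
        , ≤-reflexive (|cutFamily| k)
        , isolated-cut (removed k) (origin k) (far k) (λ ())
            (origin-survives k) (far-survives k) (origin-nbrs-removed k)
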